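{- For all integers $m, n \geq 1$, the following two quantities are both equal to $m^{n-1} s_{1/m}(n)$: (i) the number of small Schröder paths from $(0,0)$ to $(2n-2,0)$ in which each flat step is painted one of $m$ colors, i.e. $\sum_{P \in \mathcal{P}_n} m^{F(P)}$; (ii) the number of Dyck paths from $(0,0)$ to $(2n-2,0)$ in which each valley is painted one of $m+1$ colors, i.e. $\sum_{P \in \mathcal{D}_n} (m+1)^{V(P)}$.
   Context: A Schröder tree is a plane (ordered) rooted tree in which every internal node (non-leaf) has at least two children; the single-node tree has one leaf and no internal nodes. Let $s(n,k)$ be the number of Schröder trees with $n$ leaves and $k$ internal nodes, and for real $d$ let $s_d(n) = \sum_{k=0}^{n-1} s(n,k) d^k$. $\mathcal{P}_n$ is the set of small Schröder paths from $(0,0)$ to $(2n-2,0)$: lattice paths using steps $U=(1,1)$, $D=(1,-1)$, $F=(2,0)$, never going below the $x$-axis, and containing no $F$ step lying on the $x$-axis; $F(P)$ is the number of flat steps of $P$. $\mathcal{D}_n$ is the set of Dyck paths from $(0,0)$ to $(2n-2,0)$ (elements of $\mathcal{P}_n$ with no $F$ steps). A valley is an occurrence of two consecutive steps $DU$, and $V(P)$ is the number of valleys of $P$. -}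

module Defs where

open import Data.Nat as ℕ using (ℕ; zero; suc; _+_; _*_; _∸_; _≡ᵇ_)
open import Data.Bool using (Bool; true; false; _∧_; if_then_else_)
open import Data.List using (List; []; _∷_; map; concatMap; _++_; length; filter; sum; upTo)
open import Data.Integer using (ℤ; +_)
open import Data.Rational as ℚ using (ℚ)
open import Relation.Nullary.Decidable using (Dec)

data Tree : Set where
  node : List Tree → Tree

mutual
  leaves : Tree → ℕ
  leaves (node []) = 1
  leaves (node (t ∷ ts)) = leavesF (t ∷ ts)

  leavesF : List Tree → ℕ
  leavesF [] = 0
  leavesF (t ∷ ts) = leaves t + leavesF ts

mutual
  internal : Tree → ℕ
  internal (node []) = 0
  internal (node (t ∷ ts)) = suc (internalF (t ∷ ts))

  internalF : List Tree → ℕ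
  internalF [] = 0
  internalF (t ∷ ts) = internal t + internalF ts

mutual
  isSchröder : Tree → Bool
  isSchröder (node []) = true
  isSchröder (node (t ∷ [])) = false
  isSchröder (node (t ∷ u ∷ ts)) = allSch (t ∷ u ∷ ts)

  allSch : List Tree → Bool
  allSch [] = true
  allSch (t ∷ ts) = isSchröder t ∧ allSch ts

listsOfLength : {A : Set} → List A → ℕ → List (List A)
listsOfLength xs zero = [] ∷ []
listsOfLength xs (suc k) = concatMap (λ x → map (x ∷_) (listsOfLength xs k)) xs

listsUpTo : {A : Set} → List A → ℕ → List (List A)
listsUpTo xs w = concatMap (listsOfLength xs) (upTo (suc w))

-- all plane trees of height < h in which every node has at most w children
-- (each such tree occurs exactly once)
treesBounded : ℕ → ℕ → List Tree
treesBounded zero w = []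
treesBounded (suc h) w = map node (listsUpTo (treesBounded h w) w)

-- A Schröder tree with n leaves has height ≤ n - 1 < n and every node has
-- at most n children, so all of them occur in  treesBounded n n.
s : ℕ → ℕ → ℕ
s n k = length (filter (λ t → Data.Bool.T? (isSchröder t ∧ (leaves t ≡ᵇ n) ∧ (internal t ≡ᵇ k)))
                        (treesBounded n n))
  where import Data.Bool

_^ℚ_ : ℚ → ℕ → ℚ
q ^ℚ zero = ℚ.1ℚ
q ^ℚ suc k = q ℚ.* (q ^ℚ k)

sumℚ : List ℚ → ℚ
sumℚ [] = ℚ.0ℚ
sumℚ (x ∷ xs) = x ℚ.+ sumℚ xs

s[_] : ℚ → ℕ → ℚ
s[ d ] n = sumℚ (map (λ k → (+ s n k ℚ./ 1) ℚ.* (d ^ℚ k)) (upTo n))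

-- Lattice paths: U = (1,1), D = (1,-1), F = (2,0)

data Step : Set where
  U D F : Step

words : ℕ → List (List Step)
words zero = [] ∷ []
words (suc zero) = (U ∷ []) ∷ (D ∷ []) ∷ []
words (suc (suc L)) = map (U ∷_) (words (suc L)) ++ map (D ∷_) (words (suc L)) ++ map (F ∷_) (words L)

smallSchröderFrom : ℕ → List Step → Bool
smallSchröderFrom zero [] = true
smallSchröderFrom (suc h) [] = false
smallSchröderFrom h (U ∷ p) = smallSchröderFrom (suc h) p
smallSchröderFrom zero (D ∷ p) = false
smallSchröderFrom (suc h) (D ∷ p) = smallSchröderFrom h p
smallSchröderFrom zero (F ∷ p) = false
smallSchröderFrom (suc h) (F ∷ p) = smallSchröderFrom (suc h) p

isSmallSchröder : List Step → Bool
isSmallSchröder = smallSchröderFrom 0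

noFlat : List Step → Bool
noFlat [] = true
noFlat (F ∷ p) = false
noFlat (U ∷ p) = noFlat p
noFlat (D ∷ p) = noFlat p

isDyck : List Step → Bool
isDyck p = isSmallSchröder p ∧ noFlat p

flats : List Step → ℕ
flats [] = 0
flats (F ∷ p) = suc (flats p)
flats (U ∷ p) = flats p
flats (D ∷ p) = flats p

valleys : List Step → ℕ
valleys [] = 0
valleys (D ∷ U ∷ p) = suc (valleys (U ∷ p))
valleys (_ ∷ p) = valleys p

𝒫 : ℕ → List (List Step)
𝒫 n = filter (λ p → Data.Bool.T? (isSmallSchröder p)) (words (2 * n ∸ 2))
  where import Data.Bool

𝒟 : ℕ → List (List Step)
𝒟 n = filter (λ p → Data.Bool.T? (isDyck p)) (words (2 * n ∸ 2))
  where import Data.Bool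

module Submission where

-- Let p_h be the series, by x-extent, of small Schröder paths from height h to the axis with flat
-- steps weighted m. Splitting off the first step gives p₀ = 1 + x p₁ and
-- p_{h+1} = x (p_{h+2} + p_h + m x p_{h+1}), and induction on coefficients turns this into
-- p_{h+1} = p_h E with E = x (p₀ + m x p₁). Hence G = x² p₀ and Y = x E satisfy G = x² + G Y and
-- Y = G + m G Y, so G = x² + Σ_{j ≥ 2} m^(j−2) G^j. This is the equation of plane trees counted by
-- x^(2·leaves) in which a node with j children has weight m^(j−2) and unary nodes have weight 0; a
-- Schröder tree with n leaves and k internal nodes then has weight m^(n−1−k), so the coefficient of
-- x^(2n) in G is m^(n−1) s_{1/m}(n). For Dyck paths, a valley coloured by one of the m non-zero
-- colours plays the role of a flat step, so they obey the same first-step recursion.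

open import Defs

module Counting where

  open import Data.Nat using (ℕ; zero; suc; _+_; _*_; _∸_; _^_; _≤_; _<_; z≤n; s≤s; s≤s⁻¹; _≡ᵇ_)
  open import Data.Nat.Properties
  open import Data.Nat.ListAction using (sum)
  open import Data.Nat.Induction using (<-rec)
  open import Data.List using (List; []; _∷_; _++_; map; concatMap; applyUpTo; upTo; length; filter)
  open import Data.Bool using (Bool; true; false; if_then_else_; _∧_; T; T?)
  open import Data.Bool.Properties using (∧-zeroʳ)
  open import Data.Product using (Σ; _×_; _,_; proj₁; proj₂)
  open import Function using (_∘_)
  open import Relation.Binary.PropositionalEquality
  open import Relation.Nullary using (yes; no)
  open import Data.Nat.Tactic.RingSolver using (solve-∀)
  import Algebra.Properties.CommutativeSemigroup +-commutativeSemigroup as +-CS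
  open ≡-Reasoning

  ∑< : ℕ → (ℕ → ℕ) → ℕ
  ∑< zero f = 0
  ∑< (suc n) f = f 0 + ∑< n (f ∘ suc)

  ∑<-cong : ∀ n {f g : ℕ → ℕ} → (∀ i → i < n → f i ≡ g i) → ∑< n f ≡ ∑< n g
  ∑<-cong zero eq = refl
  ∑<-cong (suc n) eq = cong₂ _+_ (eq 0 (s≤s z≤n)) (∑<-cong n (λ i i<n → eq (suc i) (s≤s i<n)))

  ∑<-zero : ∀ n {f : ℕ → ℕ} → (∀ i → i < n → f i ≡ 0) → ∑< n f ≡ 0
  ∑<-zero zero eq = refl
  ∑<-zero (suc n) eq = cong₂ _+_ (eq 0 (s≤s z≤n)) (∑<-zero n (λ i i<n → eq (suc i) (s≤s i<n)))

  ∑<-+ : ∀ n (f g : ℕ → ℕ) → ∑< n (λ i → f i + g i) ≡ ∑< n f + ∑< n g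
  ∑<-+ zero f g = refl
  ∑<-+ (suc n) f g = trans (cong (f 0 + g 0 +_) (∑<-+ n (f ∘ suc) (g ∘ suc))) (+-CS.interchange (f 0) (g 0) _ _)

  ∑<-*ˡ : ∀ n c (f : ℕ → ℕ) → ∑< n (λ i → c * f i) ≡ c * ∑< n f
  ∑<-*ˡ zero c f = sym (*-zeroʳ c)
  ∑<-*ˡ (suc n) c f = trans (cong (c * f 0 +_) (∑<-*ˡ n c (f ∘ suc))) (sym (*-distribˡ-+ c (f 0) _))

  ∑<-last : ∀ n (f : ℕ → ℕ) → ∑< (suc n) f ≡ ∑< n f + f n
  ∑<-last zero f = +-comm (f 0) 0
  ∑<-last (suc n) f = trans (cong (f 0 +_) (∑<-last n (f ∘ suc))) (sym (+-assoc (f 0) _ _))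

  ∑<-pick : ∀ n a (f : ℕ → ℕ) → a < n → ∑< n (λ k → (if a ≡ᵇ k then 1 else 0) * f k) ≡ f a
  ∑<-pick (suc n) zero f _ = trans (cong₂ _+_ (+-identityʳ (f 0)) (∑<-zero n (λ _ _ → refl))) (+-identityʳ (f 0))
  ∑<-pick (suc n) (suc a) f (s≤s a<n) = ∑<-pick n a (f ∘ suc) a<n

  ∑ : {A : Set} → List A → (A → ℕ) → ℕ
  ∑ xs φ = sum (map φ xs)

  ∑-cong : {A : Set} (xs : List A) {φ ψ : A → ℕ} → (∀ x → φ x ≡ ψ x) → ∑ xs φ ≡ ∑ xs ψ
  ∑-cong [] eq = refl
  ∑-cong (x ∷ xs) eq = cong₂ _+_ (eq x) (∑-cong xs eq)

  ∑-zero : {A : Set} (xs : List A) → ∑ xs (λ _ → 0) ≡ 0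
  ∑-zero [] = refl
  ∑-zero (x ∷ xs) = ∑-zero xs

  ∑-++ : {A : Set} (xs ys : List A) (φ : A → ℕ) → ∑ (xs ++ ys) φ ≡ ∑ xs φ + ∑ ys φ
  ∑-++ [] ys φ = refl
  ∑-++ (x ∷ xs) ys φ = trans (cong (φ x +_) (∑-++ xs ys φ)) (sym (+-assoc (φ x) _ _))

  ∑-map : {A B : Set} (g : A → B) (xs : List A) (φ : B → ℕ) → ∑ (map g xs) φ ≡ ∑ xs (φ ∘ g)
  ∑-map g [] φ = refl
  ∑-map g (x ∷ xs) φ = cong (φ (g x) +_) (∑-map g xs φ)

  ∑-concatMap : {A B : Set} (g : A → List B) (xs : List A) (φ : B → ℕ) →
    ∑ (concatMap g xs) φ ≡ ∑ xs (λ x → ∑ (g x) φ)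
  ∑-concatMap g [] φ = refl
  ∑-concatMap g (x ∷ xs) φ = trans (∑-++ (g x) (concatMap g xs) φ) (cong (∑ (g x) φ +_) (∑-concatMap g xs φ))

  ∑-*ˡ : {A : Set} (xs : List A) (c : ℕ) (φ : A → ℕ) → ∑ xs (λ x → c * φ x) ≡ c * ∑ xs φ
  ∑-*ˡ [] c φ = sym (*-zeroʳ c)
  ∑-*ˡ (x ∷ xs) c φ = trans (cong (c * φ x +_) (∑-*ˡ xs c φ)) (sym (*-distribˡ-+ c (φ x) _))

  ∑-*ʳ : {A : Set} (xs : List A) (c : ℕ) (φ : A → ℕ) → ∑ xs (λ x → φ x * c) ≡ ∑ xs φ * c
  ∑-*ʳ xs c φ = trans (∑-cong xs (λ x → *-comm (φ x) c)) (trans (∑-*ˡ xs c φ) (*-comm c _))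

  ∑-+ : {A : Set} (xs : List A) (φ ψ : A → ℕ) → ∑ xs (λ x → φ x + ψ x) ≡ ∑ xs φ + ∑ xs ψ
  ∑-+ [] φ ψ = refl
  ∑-+ (x ∷ xs) φ ψ = trans (cong (φ x + ψ x +_) (∑-+ xs φ ψ)) (+-CS.interchange (φ x) (ψ x) _ _)

  ∑-filter : {A : Set} (b : A → Bool) (xs : List A) (φ : A → ℕ) →
    ∑ (filter (λ x → T? (b x)) xs) φ ≡ ∑ xs (λ x → if b x then φ x else 0)
  ∑-filter b [] φ = refl
  ∑-filter b (x ∷ xs) φ with b x
  ... | true = cong (φ x +_) (∑-filter b xs φ)
  ... | false = ∑-filter b xs φ

  length-∑ : {A : Set} (xs : List A) → length xs ≡ ∑ xs (λ _ → 1)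
  length-∑ [] = refl
  length-∑ (x ∷ xs) = cong suc (length-∑ xs)

  ∑-applyUpTo : (g : ℕ → ℕ) (n : ℕ) (φ : ℕ → ℕ) → ∑ (applyUpTo g n) φ ≡ ∑< n (φ ∘ g)
  ∑-applyUpTo g zero φ = refl
  ∑-applyUpTo g (suc n) φ = cong (φ (g 0) +_) (∑-applyUpTo (g ∘ suc) n φ)

  ∑<-∑ : {A : Set} (n : ℕ) (xs : List A) (φ : ℕ → A → ℕ) →
    ∑< n (λ i → ∑ xs (φ i)) ≡ ∑ xs (λ x → ∑< n (λ i → φ i x))
  ∑<-∑ zero xs φ = sym (∑-zero xs)
  ∑<-∑ (suc n) xs φ = trans (cong (∑ xs (φ 0) +_) (∑<-∑ n xs (φ ∘ suc))) (sym (∑-+ xs (φ 0) _))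

  if-*ˡ : ∀ (b : Bool) c x → (if b then c * x else 0) ≡ c * (if b then x else 0)
  if-*ˡ true c x = refl
  if-*ˡ false c x = sym (*-zeroʳ c)

  -- Formal power series with coefficients in ℕ

  Series : Set
  Series = ℕ → ℕ

  infixl 6 _⊕_
  infixr 8 _·_
  infixl 7 _⊛_

  _⊕_ : Series → Series → Series
  (f ⊕ g) n = f n + g n

  _·_ : ℕ → Series → Series
  (c · f) n = c * f n

  𝟘 : Series
  𝟘 _ = 0

  𝟙 : Series
  𝟙 zero = 1
  𝟙 (suc _) = 0

  X : Series → Series
  X f zero = 0
  X f (suc n) = f n

  x^ : ℕ → Series
  x^ zero = 𝟙
  x^ (suc a) = X (x^ a)

  _⊛_ : Series → Series → Series
  (f ⊛ g) n = ∑< (suc n) (λ i → f i * g (n ∸ i))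

  _^⊛_ : Series → ℕ → Series
  f ^⊛ zero = 𝟙
  f ^⊛ suc j = f ⊛ f ^⊛ j

  ∑ˢ : {A : Set} → List A → (A → Series) → Series
  ∑ˢ xs φ i = ∑ xs (λ x → φ x i)

  AgreeBelow : ℕ → Series → Series → Set
  AgreeBelow n f g = ∀ i → i < n → f i ≡ g i

  ZeroBelow : ℕ → Series → Set
  ZeroBelow n f = ∀ i → i < n → f i ≡ 0

  X-cong : ∀ {f g} → f ≗ g → X f ≗ X g
  X-cong eq zero = refl
  X-cong eq (suc n) = eq n

  X-⊕ : ∀ f g → X (f ⊕ g) ≗ X f ⊕ X g
  X-⊕ f g zero = refl
  X-⊕ f g (suc n) = refl

  X-· : ∀ c f → X (c · f) ≗ c · X f
  X-· c f zero = sym (*-zeroʳ c)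
  X-· c f (suc n) = refl

  X-𝟘 : X 𝟘 ≗ 𝟘
  X-𝟘 zero = refl
  X-𝟘 (suc n) = refl

  X²-⊕ : ∀ f g → X (X (f ⊕ g)) ≗ X (X f) ⊕ X (X g)
  X²-⊕ f g n = trans (X-cong (X-⊕ f g) n) (X-⊕ (X f) (X g) n)

  X²-· : ∀ c f → X (X (c · f)) ≗ c · X (X f)
  X²-· c f n = trans (X-cong (X-· c f) n) (X-· c (X f) n)

  X-agree : ∀ {n f g} → AgreeBelow n f g → AgreeBelow (suc n) (X f) (X g)
  X-agree eq zero _ = refl
  X-agree eq (suc i) (s≤s i<n) = eq i i<n

  ⊕-agree : ∀ {n f f′ g g′} → AgreeBelow n f f′ → AgreeBelow n g g′ → AgreeBelow n (f ⊕ g) (f′ ⊕ g′)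
  ⊕-agree ef eg i i<n = cong₂ _+_ (ef i i<n) (eg i i<n)

  ·-agree : ∀ {n f g} c → AgreeBelow n f g → AgreeBelow n (c · f) (c · g)
  ·-agree c eq i i<n = cong (c *_) (eq i i<n)

  agree-≤ : ∀ {a b f g} → a ≤ b → AgreeBelow b f g → AgreeBelow a f g
  agree-≤ a≤b eq i i<a = eq i (<-≤-trans i<a a≤b)

  ⊛-congBelow : ∀ {n f f′ g g′} → AgreeBelow (suc n) f f′ → AgreeBelow (suc n) g g′ → (f ⊛ g) n ≡ (f′ ⊛ g′) n
  ⊛-congBelow {n} ef eg = ∑<-cong (suc n) (λ i i≤n → cong₂ _*_ (ef i i≤n) (eg (n ∸ i) (s≤s (m∸n≤m n i))))

  ⊛-cong : ∀ {f f′ g g′} → f ≗ f′ → g ≗ g′ → f ⊛ g ≗ f′ ⊛ g′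
  ⊛-cong ef eg n = ⊛-congBelow (λ i _ → ef i) (λ i _ → eg i)

  ⊛-distribʳ-⊕ : ∀ f g h → (f ⊕ g) ⊛ h ≗ f ⊛ h ⊕ g ⊛ h
  ⊛-distribʳ-⊕ f g h n = trans (∑<-cong (suc n) (λ i _ → *-distribʳ-+ (h (n ∸ i)) (f i) (g i)))
    (∑<-+ (suc n) (λ i → f i * h (n ∸ i)) (λ i → g i * h (n ∸ i)))

  ⊛-distribˡ-⊕ : ∀ f g h → f ⊛ (g ⊕ h) ≗ f ⊛ g ⊕ f ⊛ h
  ⊛-distribˡ-⊕ f g h n = trans (∑<-cong (suc n) (λ i _ → *-distribˡ-+ (f i) (g (n ∸ i)) (h (n ∸ i))))
    (∑<-+ (suc n) (λ i → f i * g (n ∸ i)) (λ i → f i * h (n ∸ i)))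

  ⊛-·ˡ : ∀ c f g → (c · f) ⊛ g ≗ c · (f ⊛ g)
  ⊛-·ˡ c f g n = trans (∑<-cong (suc n) (λ i _ → *-assoc c (f i) (g (n ∸ i)))) (∑<-*ˡ (suc n) c (λ i → f i * g (n ∸ i)))

  𝟙-⊛ : ∀ f → 𝟙 ⊛ f ≗ f
  𝟙-⊛ f zero = trans (+-identityʳ _) (+-identityʳ (f 0))
  𝟙-⊛ f (suc n) = trans (cong (f (suc n) + 0 +_) (∑<-zero (suc n) (λ _ _ → refl))) (trans (+-identityʳ _) (+-identityʳ _))

  ⊛-sucʳ : ∀ f g n → (f ⊛ g) (suc n) ≡ (f ⊛ g ∘ suc) n + f (suc n) * g 0
  ⊛-sucʳ f g zero = trans (cong (f 0 * g 1 +_) (+-identityʳ (f 1 * g 0))) (cong (_+ f 1 * g 0) (sym (+-identityʳ (f 0 * g 1))))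
  ⊛-sucʳ f g (suc n) = begin
    f 0 * g (suc (suc n)) + (f ∘ suc ⊛ g) (suc n)
      ≡⟨ cong (f 0 * g (suc (suc n)) +_) (⊛-sucʳ (f ∘ suc) g n) ⟩
    f 0 * g (suc (suc n)) + ((f ∘ suc ⊛ g ∘ suc) n + f (suc (suc n)) * g 0)
      ≡⟨ sym (+-assoc (f 0 * g (suc (suc n))) _ _) ⟩
    f 0 * g (suc (suc n)) + (f ∘ suc ⊛ g ∘ suc) n + f (suc (suc n)) * g 0 ∎

  ⊛-comm : ∀ f g → f ⊛ g ≗ g ⊛ f
  ⊛-comm f g zero = cong (_+ 0) (*-comm (f 0) (g 0))
  ⊛-comm f g (suc n) = begin
    f 0 * g (suc n) + (f ∘ suc ⊛ g) n  ≡⟨ cong (f 0 * g (suc n) +_) (⊛-comm (f ∘ suc) g n) ⟩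
    f 0 * g (suc n) + (g ⊛ f ∘ suc) n  ≡⟨ +-comm (f 0 * g (suc n)) _ ⟩
    (g ⊛ f ∘ suc) n + f 0 * g (suc n)  ≡⟨ cong ((g ⊛ f ∘ suc) n +_) (*-comm (f 0) (g (suc n))) ⟩
    (g ⊛ f ∘ suc) n + g (suc n) * f 0  ≡⟨ sym (⊛-sucʳ g f n) ⟩
    (g ⊛ f) (suc n)                    ∎

  ⊛-assoc : ∀ f g h → (f ⊛ g) ⊛ h ≗ f ⊛ (g ⊛ h)
  ⊛-assoc f g h zero = cong (_+ 0) (begin
    (f 0 * g 0 + 0) * h 0  ≡⟨ cong (_* h 0) (+-identityʳ (f 0 * g 0)) ⟩
    f 0 * g 0 * h 0        ≡⟨ *-assoc (f 0) (g 0) (h 0) ⟩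
    f 0 * (g 0 * h 0)      ≡⟨ cong (f 0 *_) (sym (+-identityʳ (g 0 * h 0))) ⟩
    f 0 * (g 0 * h 0 + 0)  ∎)
  ⊛-assoc f g h (suc n) = begin
    (f ⊛ g) 0 * h (suc n) + ((f ⊛ g) ∘ suc ⊛ h) n
      ≡⟨ cong₂ _+_ (cong (_* h (suc n)) (+-identityʳ (f 0 * g 0)))
           (⊛-cong {(f ⊛ g) ∘ suc} {f 0 · g ∘ suc ⊕ f ∘ suc ⊛ g} {h} (λ _ → refl) (λ _ → refl) n) ⟩
    f 0 * g 0 * h (suc n) + ((f 0 · g ∘ suc ⊕ f ∘ suc ⊛ g) ⊛ h) n
      ≡⟨ cong (f 0 * g 0 * h (suc n) +_) (trans (⊛-distribʳ-⊕ (f 0 · g ∘ suc) (f ∘ suc ⊛ g) h n)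
           (cong₂ _+_ (⊛-·ˡ (f 0) (g ∘ suc) h n) (⊛-assoc (f ∘ suc) g h n))) ⟩
    f 0 * g 0 * h (suc n) + (f 0 * (g ∘ suc ⊛ h) n + (f ∘ suc ⊛ (g ⊛ h)) n)
      ≡⟨ sym (+-assoc (f 0 * g 0 * h (suc n)) _ _) ⟩
    f 0 * g 0 * h (suc n) + f 0 * (g ∘ suc ⊛ h) n + (f ∘ suc ⊛ (g ⊛ h)) n
      ≡⟨ cong (_+ (f ∘ suc ⊛ (g ⊛ h)) n) (trans (cong (_+ f 0 * (g ∘ suc ⊛ h) n) (*-assoc (f 0) (g 0) (h (suc n))))
           (sym (*-distribˡ-+ (f 0) _ _))) ⟩
    f 0 * (g ⊛ h) (suc n) + (f ∘ suc ⊛ (g ⊛ h)) n ∎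

  ⊛-𝟙 : ∀ f → f ⊛ 𝟙 ≗ f
  ⊛-𝟙 f n = trans (⊛-comm f 𝟙 n) (𝟙-⊛ f n)

  ⊛-·ʳ : ∀ c f g → f ⊛ (c · g) ≗ c · (f ⊛ g)
  ⊛-·ʳ c f g n = trans (⊛-comm f (c · g) n) (trans (⊛-·ˡ c g f n) (cong (c *_) (⊛-comm g f n)))

  ·-⊛-· : ∀ c d f g → (c · f) ⊛ (d · g) ≗ (c * d) · (f ⊛ g)
  ·-⊛-· c d f g n = begin
    ((c · f) ⊛ (d · g)) n  ≡⟨ ⊛-·ˡ c f (d · g) n ⟩
    c * (f ⊛ (d · g)) n    ≡⟨ cong (c *_) (⊛-·ʳ d f g n) ⟩
    c * (d * (f ⊛ g) n)    ≡⟨ sym (*-assoc c d _) ⟩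
    c * d * (f ⊛ g) n      ∎

  X-⊛ : ∀ f g → X f ⊛ g ≗ X (f ⊛ g)
  X-⊛ f g zero = refl
  X-⊛ f g (suc n) = refl

  ⊛-X : ∀ f g → f ⊛ X g ≗ X (f ⊛ g)
  ⊛-X f g n = trans (⊛-comm f (X g) n) (trans (X-⊛ g f n) (X-cong (⊛-comm g f) n))

  x^-⊛ : ∀ a b → x^ a ⊛ x^ b ≗ x^ (a + b)
  x^-⊛ zero b = 𝟙-⊛ (x^ b)
  x^-⊛ (suc a) b n = trans (X-⊛ (x^ a) (x^ b) n) (X-cong (x^-⊛ a b) n)

  x^-double : ∀ a b → x^ (2 * a) (2 * b) ≡ (if a ≡ᵇ b then 1 else 0)
  x^-double zero zero = refl
  x^-double zero (suc b) = refl
  x^-double (suc a) zero = refl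
  x^-double (suc a) (suc b) rewrite +-suc a (a + 0) | +-suc b (b + 0) = x^-double a b

  ∑ˢ-⊛ : {A : Set} (xs : List A) (φ : A → Series) (g : Series) → ∑ˢ xs φ ⊛ g ≗ ∑ˢ xs (λ x → φ x ⊛ g)
  ∑ˢ-⊛ xs φ g n = begin
    ∑< (suc n) (λ i → ∑ xs (λ x → φ x i) * g (n ∸ i))
      ≡⟨ ∑<-cong (suc n) (λ i _ → sym (∑-*ʳ xs (g (n ∸ i)) (λ x → φ x i))) ⟩
    ∑< (suc n) (λ i → ∑ xs (λ x → φ x i * g (n ∸ i)))
      ≡⟨ ∑<-∑ (suc n) xs (λ i x → φ x i * g (n ∸ i)) ⟩
    ∑ xs (λ x → (φ x ⊛ g) n) ∎

  ⊛-∑ˢ : {A : Set} (f : Series) (xs : List A) (φ : A → Series) → f ⊛ ∑ˢ xs φ ≗ ∑ˢ xs (λ x → f ⊛ φ x)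
  ⊛-∑ˢ f xs φ n = trans (⊛-comm f (∑ˢ xs φ) n) (trans (∑ˢ-⊛ xs φ f n) (∑-cong xs (λ x → ⊛-comm (φ x) f n)))

  zeroBelow-≤ : ∀ {a b f} → a ≤ b → ZeroBelow b f → ZeroBelow a f
  zeroBelow-≤ a≤b zf i i<a = zf i (<-≤-trans i<a a≤b)

  x^-zeroBelow : ∀ a → ZeroBelow a (x^ a)
  x^-zeroBelow (suc a) zero _ = refl
  x^-zeroBelow (suc a) (suc i) (s≤s i<a) = x^-zeroBelow a i i<a

  ⊛-zeroBelow : ∀ {a b f g} → ZeroBelow a f → ZeroBelow b g → ZeroBelow (a + b) (f ⊛ g)
  ⊛-zeroBelow {a} {b} {f} {g} zf zg n n<a+b = ∑<-zero (suc n) term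
    where
    term : ∀ i → i < suc n → f i * g (n ∸ i) ≡ 0
    term i (s≤s i≤n) with i <? a
    ... | yes i<a = cong (_* g (n ∸ i)) (zf i i<a)
    ... | no i≮a = trans (cong (f i *_) (zg (n ∸ i) n∸i<b)) (*-zeroʳ (f i))
      where
      n∸i<b : n ∸ i < b
      n∸i<b = +-cancelˡ-< i (n ∸ i) b
        (≤-<-trans (≤-reflexive (m+[n∸m]≡n i≤n)) (<-≤-trans n<a+b (+-monoˡ-≤ b (≮⇒≥ i≮a))))

  ^⊛-zeroBelow : ∀ {a f} → ZeroBelow a f → ∀ j → ZeroBelow (j * a) (f ^⊛ j)
  ^⊛-zeroBelow zf zero i ()
  ^⊛-zeroBelow zf (suc j) = ⊛-zeroBelow zf (^⊛-zeroBelow zf j)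

  ^⊛-agree : ∀ {n f g} → AgreeBelow n f g → ∀ j → AgreeBelow n (f ^⊛ j) (g ^⊛ j)
  ^⊛-agree eq zero i _ = refl
  ^⊛-agree eq (suc j) i i<n = ⊛-congBelow (agree-≤ i<n eq) (agree-≤ i<n (^⊛-agree eq j))

  ⊛-congʳ-zeroBelow : ∀ {a L f g g′} → ZeroBelow a f → (∀ i → a + i ≤ L → g i ≡ g′ i) → (f ⊛ g) L ≡ (f ⊛ g′) L
  ⊛-congʳ-zeroBelow {a} {L} {f} {g} {g′} zf eq = ∑<-cong (suc L) term
    where
    term : ∀ i → i < suc L → f i * g (L ∸ i) ≡ f i * g′ (L ∸ i)
    term i (s≤s i≤L) with i <? a
    ... | yes i<a = trans (cong (_* g (L ∸ i)) (zf i i<a)) (sym (cong (_* g′ (L ∸ i)) (zf i i<a)))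
    ... | no i≮a = cong (f i *_) (eq (L ∸ i) (≤-trans (+-monoˡ-≤ (L ∸ i) (≮⇒≥ i≮a)) (≤-reflexive (m+[n∸m]≡n i≤L))))

  ⊛-cong-zeroBelow : ∀ {a L f f′ g g′} → ZeroBelow a f → ZeroBelow a g′ →
    (∀ i → a + i ≤ L → f i ≡ g i) → (∀ i → a + i ≤ L → f′ i ≡ g′ i) → (f ⊛ f′) L ≡ (g ⊛ g′) L
  ⊛-cong-zeroBelow {L = L} {f} {f′} {g} {g′} zf zg′ eq eq′ = begin
    (f ⊛ f′) L  ≡⟨ ⊛-congʳ-zeroBelow zf eq′ ⟩
    (f ⊛ g′) L  ≡⟨ ⊛-comm f g′ L ⟩
    (g′ ⊛ f) L  ≡⟨ ⊛-congʳ-zeroBelow zg′ eq ⟩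
    (g′ ⊛ g) L  ≡⟨ ⊛-comm g′ g L ⟩
    (g ⊛ g′) L  ∎

  -- Weighted lattice paths

  ∑-words-suc : ∀ (φ : List Step → ℕ) L → ∑ (words (suc L)) φ ≡
    ∑ (words L) (φ ∘ (U ∷_)) + ∑ (words L) (φ ∘ (D ∷_)) + X (λ k → ∑ (words k) (φ ∘ (F ∷_))) L
  ∑-words-suc φ zero = sym (trans (+-identityʳ _) (cong (_+ (φ (D ∷ []) + 0)) (+-identityʳ (φ (U ∷ [])))))
  ∑-words-suc φ (suc L) = begin
    ∑ (map (U ∷_) ws ++ map (D ∷_) ws ++ map (F ∷_) (words L)) φ
      ≡⟨ ∑-++ (map (U ∷_) ws) _ φ ⟩
    ∑ (map (U ∷_) ws) φ + ∑ (map (D ∷_) ws ++ map (F ∷_) (words L)) φ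
      ≡⟨ cong (∑ (map (U ∷_) ws) φ +_) (∑-++ (map (D ∷_) ws) _ φ) ⟩
    ∑ (map (U ∷_) ws) φ + (∑ (map (D ∷_) ws) φ + ∑ (map (F ∷_) (words L)) φ)
      ≡⟨ sym (+-assoc (∑ (map (U ∷_) ws) φ) _ _) ⟩
    ∑ (map (U ∷_) ws) φ + ∑ (map (D ∷_) ws) φ + ∑ (map (F ∷_) (words L)) φ
      ≡⟨ cong₂ _+_ (cong₂ _+_ (∑-map (U ∷_) ws φ) (∑-map (D ∷_) ws φ)) (∑-map (F ∷_) (words L) φ) ⟩
    ∑ ws (φ ∘ (U ∷_)) + ∑ ws (φ ∘ (D ∷_)) + ∑ (words L) (φ ∘ (F ∷_)) ∎
    where ws = words (suc L)

  ∑-words-suc-noFlat : ∀ (φ : List Step → ℕ) L → (∀ p → φ (F ∷ p) ≡ 0) →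
    ∑ (words (suc L)) φ ≡ ∑ (words L) (φ ∘ (U ∷_)) + ∑ (words L) (φ ∘ (D ∷_))
  ∑-words-suc-noFlat φ L φF≡0 = begin
    ∑ (words (suc L)) φ ≡⟨ ∑-words-suc φ L ⟩
    ∑ (words L) (φ ∘ (U ∷_)) + ∑ (words L) (φ ∘ (D ∷_)) + X (λ k → ∑ (words k) (φ ∘ (F ∷_))) L
      ≡⟨ cong (∑ (words L) (φ ∘ (U ∷_)) + ∑ (words L) (φ ∘ (D ∷_)) +_) (trans (X-cong noFlatPart L) (X-𝟘 L)) ⟩
    ∑ (words L) (φ ∘ (U ∷_)) + ∑ (words L) (φ ∘ (D ∷_)) + 0 ≡⟨ +-identityʳ _ ⟩
    ∑ (words L) (φ ∘ (U ∷_)) + ∑ (words L) (φ ∘ (D ∷_)) ∎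
    where
    noFlatPart : (λ k → ∑ (words k) (φ ∘ (F ∷_))) ≗ 𝟘
    noFlatPart k = trans (∑-cong (words k) φF≡0) (∑-zero (words k))

  module SchröderPaths (m : ℕ) where

    small : ℕ → List Step → ℕ
    small h p = if smallSchröderFrom h p then m ^ flats p else 0

    paths : ℕ → Series
    paths h L = ∑ (words L) (small h)

    down : ℕ → Series
    down h = paths h ⊕ m · X (paths (suc h))

    small-U : ∀ h p → small h (U ∷ p) ≡ small (suc h) p
    small-U zero p = refl
    small-U (suc h) p = refl

    small-F : ∀ h p → small (suc h) (F ∷ p) ≡ m * small (suc h) p
    small-F h p = if-*ˡ (smallSchröderFrom (suc h) p) m (m ^ flats p)

    paths-zero : ∀ h → paths h 0 ≡ 𝟙 h
    paths-zero zero = refl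
    paths-zero (suc h) = refl

    paths-firstStep₀ : paths 0 ≗ 𝟙 ⊕ X (paths 1)
    paths-firstStep₀ zero = refl
    paths-firstStep₀ (suc L) = begin
      paths 0 (suc L)  ≡⟨ ∑-words-suc-noFlat (small 0) L (λ _ → refl) ⟩
      ∑ (words L) (small 0 ∘ (U ∷_)) + ∑ (words L) (λ _ → 0)
        ≡⟨ cong₂ _+_ (∑-cong (words L) (small-U 0)) (∑-zero (words L)) ⟩
      paths 1 L + 0  ≡⟨ +-identityʳ _ ⟩
      paths 1 L ∎

    paths-firstStepₛ : ∀ h → paths (suc h) ≗ X (paths (suc (suc h)) ⊕ down h)
    paths-firstStepₛ h zero = refl
    paths-firstStepₛ h (suc L) = begin
      paths (suc h) (suc L)  ≡⟨ ∑-words-suc (small (suc h)) L ⟩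
      ∑ (words L) (small (suc h) ∘ (U ∷_)) + paths h L + X (λ k → ∑ (words k) (small (suc h) ∘ (F ∷_))) L
        ≡⟨ cong₂ _+_ (cong (_+ paths h L) (∑-cong (words L) (small-U (suc h))))
                     (trans (X-cong flat L) (X-· m (paths (suc h)) L)) ⟩
      paths (suc (suc h)) L + paths h L + m * X (paths (suc h)) L
        ≡⟨ +-assoc (paths (suc (suc h)) L) _ _ ⟩
      paths (suc (suc h)) L + down h L ∎
      where
      flat : (λ k → ∑ (words k) (small (suc h) ∘ (F ∷_))) ≗ m · paths (suc h)
      flat k = trans (∑-cong (words k) (small-F h)) (∑-*ˡ (words k) m (small (suc h)))

    valleysAfter : Bool → List Step → ℕ
    valleysAfter false p = valleys p
    valleysAfter true p = valleys (D ∷ p)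

    dyck : Bool → ℕ → List Step → ℕ
    dyck b h p = if smallSchröderFrom h p ∧ noFlat p then suc m ^ valleysAfter b p else 0

    dyckPaths : Bool → ℕ → Series
    dyckPaths b h L = ∑ (words L) (dyck b h)

    upWeight : Bool → ℕ
    upWeight false = 1
    upWeight true = suc m

    dyck-U : ∀ b h p → dyck b h (U ∷ p) ≡ upWeight b * dyck false (suc h) p
    dyck-U false zero p = sym (*-identityˡ _)
    dyck-U false (suc h) p = sym (*-identityˡ _)
    dyck-U true zero p = if-*ˡ (smallSchröderFrom 1 p ∧ noFlat p) (suc m) _
    dyck-U true (suc h) p = if-*ˡ (smallSchröderFrom (suc (suc h)) p ∧ noFlat p) (suc m) _

    dyck-D : ∀ b h p → dyck b (suc h) (D ∷ p) ≡ dyck true h p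
    dyck-D false h p = refl
    dyck-D true h p = refl

    dyck-F : ∀ b h p → dyck b h (F ∷ p) ≡ 0
    dyck-F b zero p = refl
    dyck-F b (suc h) p rewrite ∧-zeroʳ (smallSchröderFrom (suc h) p) = refl

    dyckPaths-zero : ∀ b h → dyckPaths b h 0 ≡ 𝟙 h
    dyckPaths-zero false zero = refl
    dyckPaths-zero false (suc h) = refl
    dyckPaths-zero true zero = refl
    dyckPaths-zero true (suc h) = refl

    dyckPaths-firstStep₀ : ∀ b L → dyckPaths b 0 (suc L) ≡ upWeight b * dyckPaths false 1 L
    dyckPaths-firstStep₀ b L = begin
      dyckPaths b 0 (suc L) ≡⟨ ∑-words-suc-noFlat (dyck b 0) L (dyck-F b 0) ⟩
      ∑ (words L) (dyck b 0 ∘ (U ∷_)) + ∑ (words L) (λ _ → 0)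
        ≡⟨ cong₂ _+_ (∑-cong (words L) (dyck-U b 0)) (∑-zero (words L)) ⟩
      ∑ (words L) (λ p → upWeight b * dyck false 1 p) + 0
        ≡⟨ trans (+-identityʳ _) (∑-*ˡ (words L) (upWeight b) (dyck false 1)) ⟩
      upWeight b * dyckPaths false 1 L ∎

    dyckPaths-firstStepₛ : ∀ b h L → dyckPaths b (suc h) (suc L) ≡ upWeight b * dyckPaths false (suc (suc h)) L + dyckPaths true h L
    dyckPaths-firstStepₛ b h L = begin
      dyckPaths b (suc h) (suc L) ≡⟨ ∑-words-suc-noFlat (dyck b (suc h)) L (dyck-F b (suc h)) ⟩
      ∑ (words L) (dyck b (suc h) ∘ (U ∷_)) + ∑ (words L) (dyck b (suc h) ∘ (D ∷_))
        ≡⟨ cong₂ _+_ (trans (∑-cong (words L) (dyck-U b (suc h))) (∑-*ˡ (words L) (upWeight b) (dyck false (suc (suc h)))))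
                     (∑-cong (words L) (dyck-D b h)) ⟩
      upWeight b * dyckPaths false (suc (suc h)) L + dyckPaths true h L ∎

    dyck≡paths : ∀ L h → dyckPaths false h L ≡ paths h L × dyckPaths true h L ≡ down h L
    dyck≡paths zero h = trans (dyckPaths-zero false h) (sym (paths-zero h)) ,
      trans (dyckPaths-zero true h) (sym (trans (cong (paths h 0 +_) (*-zeroʳ m)) (trans (+-identityʳ _) (paths-zero h))))
    dyck≡paths (suc L) zero =
      trans (dyckPaths-firstStep₀ false L) (trans (*-identityˡ _) (trans dF≡ (sym (paths-firstStep₀ (suc L))))) ,
      trans (dyckPaths-firstStep₀ true L) (trans (cong (suc m *_) dF≡) (cong (_+ m * paths 1 L) (sym (paths-firstStep₀ (suc L)))))
      where
      dF≡ : dyckPaths false 1 L ≡ paths 1 L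
      dF≡ = proj₁ (dyck≡paths L 1)
    dyck≡paths (suc L) (suc h) =
      trans (dyckPaths-firstStepₛ false h L)
        (trans (cong₂ _+_ (trans (*-identityˡ _) dF≡) dT≡) (sym (paths-firstStepₛ h (suc L)))) ,
      (begin
        dyckPaths true (suc h) (suc L)  ≡⟨ dyckPaths-firstStepₛ true h L ⟩
        suc m * dyckPaths false (suc (suc h)) L + dyckPaths true h L  ≡⟨ cong₂ _+_ (cong (suc m *_) dF≡) dT≡ ⟩
        a + m * a + down h L  ≡⟨ +-CS.xy∙z≈xz∙y a (m * a) (down h L) ⟩
        a + down h L + m * a  ≡⟨ cong (_+ m * a) (sym (paths-firstStepₛ h (suc L))) ⟩
        down (suc h) (suc L) ∎)
      where
      a = paths (suc (suc h)) L
      dF≡ : dyckPaths false (suc (suc h)) L ≡ a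
      dF≡ = proj₁ (dyck≡paths L (suc (suc h)))
      dT≡ : dyckPaths true h L ≡ down h L
      dT≡ = proj₂ (dyck≡paths L h)

    E : Series
    E = X (down 0)

    down-⊛ : ∀ h f → down h ⊛ f ≗ paths h ⊛ f ⊕ m · X (paths (suc h) ⊛ f)
    down-⊛ h f L = begin
      (down h ⊛ f) L  ≡⟨ ⊛-distribʳ-⊕ (paths h) (m · X (paths (suc h))) f L ⟩
      (paths h ⊛ f) L + ((m · X (paths (suc h))) ⊛ f) L
        ≡⟨ cong ((paths h ⊛ f) L +_) (trans (⊛-·ˡ m (X (paths (suc h))) f L) (cong (m *_) (X-⊛ (paths (suc h)) f L))) ⟩
      (paths h ⊛ f) L + m * X (paths (suc h) ⊛ f) L ∎

    paths-factorAt : ∀ L → (∀ h → AgreeBelow L (paths h ⊛ E) (paths (suc h))) →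
      ∀ h → (paths h ⊛ E) L ≡ paths (suc h) L
    paths-factorAt L below zero = begin
      (paths 0 ⊛ E) L                  ≡⟨ ⊛-cong {g = E} paths-firstStep₀ (λ _ → refl) L ⟩
      ((𝟙 ⊕ X (paths 1)) ⊛ E) L         ≡⟨ ⊛-distribʳ-⊕ 𝟙 (X (paths 1)) E L ⟩
      (𝟙 ⊛ E) L + (X (paths 1) ⊛ E) L   ≡⟨ cong₂ _+_ (𝟙-⊛ E L) (X-⊛ (paths 1) E L) ⟩
      E L + X (paths 1 ⊛ E) L           ≡⟨ cong (E L +_) (X-agree (below 1) L (n<1+n L)) ⟩
      X (down 0) L + X (paths 2) L      ≡⟨ +-comm (X (down 0) L) _ ⟩
      X (paths 2) L + X (down 0) L      ≡⟨ sym (trans (paths-firstStepₛ 0 L) (X-⊕ (paths 2) (down 0) L)) ⟩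
      paths 1 L ∎
    paths-factorAt L below (suc h) = begin
      (paths (suc h) ⊛ E) L
        ≡⟨ ⊛-cong {g = E} (paths-firstStepₛ h) (λ _ → refl) L ⟩
      (X (paths (suc (suc h)) ⊕ down h) ⊛ E) L
        ≡⟨ trans (X-⊛ (paths (suc (suc h)) ⊕ down h) E L) (X-cong (⊛-distribʳ-⊕ (paths (suc (suc h))) (down h) E) L) ⟩
      X (paths (suc (suc h)) ⊛ E ⊕ down h ⊛ E) L
        ≡⟨ X-agree (⊕-agree (below (suc (suc h))) downBelow) L (n<1+n L) ⟩
      X (paths (suc (suc (suc h))) ⊕ down (suc h)) L
        ≡⟨ sym (paths-firstStepₛ (suc h) L) ⟩
      paths (suc (suc h)) L ∎
      where
      downBelow : AgreeBelow L (down h ⊛ E) (down (suc h))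
      downBelow i i<L = trans (down-⊛ h E i)
        (⊕-agree (below h) (·-agree m (agree-≤ (n≤1+n L) (X-agree (below (suc h))))) i i<L)

    paths-factor : ∀ h → paths h ⊛ E ≗ paths (suc h)
    paths-factor h L = <-rec (λ L → ∀ h → (paths h ⊛ E) L ≡ paths (suc h) L)
      (λ L IH → paths-factorAt L (λ h i i<L → IH i<L h)) L h

    -- Indexed so that a path of extent 2n − 2 and a tree with n leaves both sit at x^(2n).
    G : Series
    G = X (X (paths 0))

    Y : Series
    Y = X E

    G⊛Y : G ⊛ Y ≗ X (X (X (paths 1)))
    G⊛Y L = begin
      (X (X (paths 0)) ⊛ X E) L  ≡⟨ X-⊛ (X (paths 0)) (X E) L ⟩
      X (X (paths 0) ⊛ X E) L    ≡⟨ X-cong (λ k → trans (X-⊛ (paths 0) (X E) k) (X-cong (⊛-X (paths 0) E) k)) L ⟩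
      X (X (X (paths 0 ⊛ E))) L  ≡⟨ X-cong (X-cong (X-cong (paths-factor 0))) L ⟩
      X (X (X (paths 1))) L      ∎

    G-equation : G ≗ X (X 𝟙) ⊕ G ⊛ Y
    G-equation L = begin
      X (X (paths 0)) L               ≡⟨ X-cong (X-cong paths-firstStep₀) L ⟩
      X (X (𝟙 ⊕ X (paths 1))) L       ≡⟨ X²-⊕ 𝟙 (X (paths 1)) L ⟩
      X (X 𝟙) L + X (X (X (paths 1))) L ≡⟨ cong (X (X 𝟙) L +_) (sym (G⊛Y L)) ⟩
      X (X 𝟙) L + (G ⊛ Y) L           ∎

    Y-equation : Y ≗ G ⊕ m · (G ⊛ Y)
    Y-equation L = begin
      X (X (paths 0 ⊕ m · X (paths 1))) L      ≡⟨ X²-⊕ (paths 0) (m · X (paths 1)) L ⟩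
      G L + X (X (m · X (paths 1))) L         ≡⟨ cong (G L +_) (X²-· m (X (paths 1)) L) ⟩
      G L + m * X (X (X (paths 1))) L         ≡⟨ cong (λ z → G L + m * z) (sym (G⊛Y L)) ⟩
      G L + m * (G ⊛ Y) L                     ∎

  -- Weighted plane trees

  leaves-pos : ∀ t → 1 ≤ leaves t
  leaves-pos (node []) = s≤s z≤n
  leaves-pos (node (t ∷ ts)) = ≤-trans (leaves-pos t) (m≤m+n (leaves t) (leavesF ts))

  ∑-listsOfLength-suc : {A : Set} (xs : List A) (j : ℕ) (φ : List A → ℕ) →
    ∑ (listsOfLength xs (suc j)) φ ≡ ∑ xs (λ x → ∑ (listsOfLength xs j) (φ ∘ (x ∷_)))
  ∑-listsOfLength-suc xs j φ =
    trans (∑-concatMap _ xs φ) (∑-cong xs (λ x → ∑-map (x ∷_) (listsOfLength xs j) φ))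

  ∑-listsOfLength : {A : Set} (xs : List A) (j : ℕ) (c : ℕ → ℕ) (φ : List A → ℕ) →
    ∑ (listsOfLength xs j) (λ ts → c (length ts) * φ ts) ≡ c j * ∑ (listsOfLength xs j) φ
  ∑-listsOfLength xs zero c φ = ∑-*ˡ (listsOfLength xs zero) (c 0) φ
  ∑-listsOfLength xs (suc j) c φ = begin
    ∑ (listsOfLength xs (suc j)) (λ ts → c (length ts) * φ ts)
      ≡⟨ ∑-listsOfLength-suc xs j _ ⟩
    ∑ xs (λ x → ∑ (listsOfLength xs j) (λ ts → c (suc (length ts)) * φ (x ∷ ts)))
      ≡⟨ ∑-cong xs (λ x → ∑-listsOfLength xs j (c ∘ suc) (φ ∘ (x ∷_))) ⟩
    ∑ xs (λ x → c (suc j) * ∑ (listsOfLength xs j) (φ ∘ (x ∷_)))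
      ≡⟨ ∑-*ˡ xs (c (suc j)) _ ⟩
    c (suc j) * ∑ xs (λ x → ∑ (listsOfLength xs j) (φ ∘ (x ∷_)))
      ≡⟨ cong (c (suc j) *_) (sym (∑-listsOfLength-suc xs j φ)) ⟩
    c (suc j) * ∑ (listsOfLength xs (suc j)) φ ∎

  module WeightedTrees (m : ℕ) where

    -- Unary nodes get weight 0, so only Schröder trees contribute.
    arityWeight : ℕ → ℕ
    arityWeight zero = 1
    arityWeight (suc zero) = 0
    arityWeight (suc (suc j)) = m ^ j

    mutual
      weight : Tree → ℕ
      weight (node ts) = arityWeight (length ts) * weightF ts

      weightF : List Tree → ℕ
      weightF [] = 1
      weightF (t ∷ ts) = weight t * weightF ts

    treeTerm : Tree → Series
    treeTerm t = weight t · x^ (2 * leaves t)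

    forestTerm : List Tree → Series
    forestTerm ts = weightF ts · x^ (2 * leavesF ts)

    treeSeries : List Tree → Series
    treeSeries xs = ∑ˢ xs treeTerm

    forestSeries : List (List Tree) → Series
    forestSeries xss = ∑ˢ xss forestTerm

    treeTerm-⊛ : ∀ t ts → treeTerm t ⊛ forestTerm ts ≗ forestTerm (t ∷ ts)
    treeTerm-⊛ t ts k = begin
      (treeTerm t ⊛ forestTerm ts) k
        ≡⟨ ·-⊛-· (weight t) (weightF ts) (x^ (2 * leaves t)) (x^ (2 * leavesF ts)) k ⟩
      weightF (t ∷ ts) * (x^ (2 * leaves t) ⊛ x^ (2 * leavesF ts)) k
        ≡⟨ cong (weightF (t ∷ ts) *_) (trans (x^-⊛ (2 * leaves t) (2 * leavesF ts) k)
             (cong (λ a → x^ a k) (sym (*-distribˡ-+ 2 (leaves t) (leavesF ts))))) ⟩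
      forestTerm (t ∷ ts) k ∎

    treeSeries-^⊛ : ∀ xs j → treeSeries xs ^⊛ j ≗ forestSeries (listsOfLength xs j)
    treeSeries-^⊛ xs zero n = sym (trans (+-identityʳ _) (*-identityˡ (𝟙 n)))
    treeSeries-^⊛ xs (suc j) n = begin
      (treeSeries xs ⊛ treeSeries xs ^⊛ j) n
        ≡⟨ ⊛-cong {treeSeries xs} (λ _ → refl) (treeSeries-^⊛ xs j) n ⟩
      (treeSeries xs ⊛ forestSeries tss) n
        ≡⟨ ∑ˢ-⊛ xs treeTerm (forestSeries tss) n ⟩
      ∑ xs (λ t → (treeTerm t ⊛ forestSeries tss) n)
        ≡⟨ ∑-cong xs (λ t → trans (⊛-∑ˢ (treeTerm t) tss forestTerm n) (∑-cong tss (λ ts → treeTerm-⊛ t ts n))) ⟩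
      ∑ xs (λ t → ∑ tss (λ ts → forestTerm (t ∷ ts) n))
        ≡⟨ sym (∑-listsOfLength-suc xs j _) ⟩
      forestSeries (listsOfLength xs (suc j)) n ∎
      where
      tss = listsOfLength xs j

    treeSeries-treesBounded : ∀ h w L → treeSeries (treesBounded (suc h) w) L ≡
      x^ 2 L + ∑< w (λ j → arityWeight (suc j) * (treeSeries (treesBounded h w) ^⊛ suc j) L)
    treeSeries-treesBounded h w L = begin
      ∑ (map node (concatMap (listsOfLength trees) (upTo (suc w)))) ψ
        ≡⟨ ∑-map node (concatMap (listsOfLength trees) (upTo (suc w))) ψ ⟩
      ∑ (concatMap (listsOfLength trees) (upTo (suc w))) (ψ ∘ node)
        ≡⟨ ∑-concatMap (listsOfLength trees) (upTo (suc w)) (ψ ∘ node) ⟩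
      ∑ (upTo (suc w)) (λ j → ∑ (listsOfLength trees j) (ψ ∘ node))
        ≡⟨ ∑-applyUpTo (λ j → j) (suc w) _ ⟩
      ∑ (listsOfLength trees 0) (ψ ∘ node) + ∑< w (λ j → ∑ (listsOfLength trees (suc j)) (ψ ∘ node))
        ≡⟨ cong₂ _+_ (trans (+-identityʳ _) (*-identityˡ (x^ 2 L))) (∑<-cong w (λ j _ → arity j)) ⟩
      x^ 2 L + ∑< w (λ j → arityWeight (suc j) * (treeSeries trees ^⊛ suc j) L) ∎
      where
      trees = treesBounded h w
      ψ : Tree → ℕ
      ψ t = treeTerm t L
      arity : ∀ j → ∑ (listsOfLength trees (suc j)) (ψ ∘ node) ≡ arityWeight (suc j) * (treeSeries trees ^⊛ suc j) L
      arity j = begin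
        ∑ (listsOfLength trees (suc j)) (ψ ∘ node)
          ≡⟨ ∑-listsOfLength-suc trees j (ψ ∘ node) ⟩
        ∑ trees (λ t → ∑ (listsOfLength trees j) (λ ts → ψ (node (t ∷ ts))))
          ≡⟨ ∑-cong trees (λ t → ∑-cong (listsOfLength trees j) (λ ts → *-assoc (arityWeight (suc (length ts))) _ _)) ⟩
        ∑ trees (λ t → ∑ (listsOfLength trees j) (λ ts → arityWeight (length (t ∷ ts)) * forestTerm (t ∷ ts) L))
          ≡⟨ sym (∑-listsOfLength-suc trees j _) ⟩
        ∑ (listsOfLength trees (suc j)) (λ ts → arityWeight (length ts) * forestTerm ts L)
          ≡⟨ ∑-listsOfLength trees (suc j) arityWeight (λ ts → forestTerm ts L) ⟩
        arityWeight (suc j) * forestSeries (listsOfLength trees (suc j)) L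
          ≡⟨ cong (arityWeight (suc j) *_) (sym (treeSeries-^⊛ trees (suc j) L)) ⟩
        arityWeight (suc j) * (treeSeries trees ^⊛ suc j) L ∎

  schröderSum : ℕ → ℕ → ℕ
  schröderSum m n = ∑< n (λ k → s n k * m ^ (n ∸ 1 ∸ k))

  module SchröderWeights (m : ℕ) where
    open WeightedTrees m

    mutual
      weight-schröder : ∀ t → isSchröder t ≡ true →
        Σ ℕ (λ r → (leaves t ≡ r + suc (internal t)) × (weight t ≡ m ^ r))
      weight-schröder (node []) _ = 0 , refl , refl
      weight-schröder (node (t ∷ [])) ()
      weight-schröder (node (t ∷ u ∷ ts)) sch with weightF-schröder (t ∷ u ∷ ts) sch
      ... | r , leaves≡ , weight≡ = length ts + r ,
        trans leaves≡ (leaves-node-identity r (length ts) (internalF (t ∷ u ∷ ts))) ,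
        trans (cong (m ^ length ts *_) weight≡) (sym (^-distribˡ-+-* m (length ts) r))
        where
        leaves-node-identity : ∀ r l K → r + (2 + l + K) ≡ (l + r) + (1 + (1 + K))
        leaves-node-identity = solve-∀

      weightF-schröder : ∀ ts → allSch ts ≡ true →
        Σ ℕ (λ r → (leavesF ts ≡ r + (length ts + internalF ts)) × (weightF ts ≡ m ^ r))
      weightF-schröder [] _ = 0 , refl , refl
      weightF-schröder (t ∷ ts) sch with isSchröder t in t-sch | allSch ts in ts-sch
      weightF-schröder (t ∷ ts) () | false | _
      weightF-schröder (t ∷ ts) () | true | false
      ... | true | true with weight-schröder t t-sch | weightF-schröder ts ts-sch
      ... | r₁ , l₁ , w₁ | r₂ , l₂ , w₂ = r₁ + r₂ ,
        trans (cong₂ _+_ l₁ l₂) (leaves-cons-identity r₁ (internal t) r₂ (length ts) (internalF ts)) ,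
        trans (cong₂ _*_ w₁ w₂) (sym (^-distribˡ-+-* m r₁ r₂))
        where
        leaves-cons-identity : ∀ r₁ k₁ r₂ l K → (r₁ + (1 + k₁)) + (r₂ + (l + K)) ≡ (r₁ + r₂) + ((1 + l) + (k₁ + K))
        leaves-cons-identity = solve-∀

    mutual
      weight-nonSchröder : ∀ t → isSchröder t ≡ false → weight t ≡ 0
      weight-nonSchröder (node []) ()
      weight-nonSchröder (node (t ∷ [])) _ = refl
      weight-nonSchröder (node (t ∷ u ∷ ts)) nsch =
        trans (cong (m ^ length ts *_) (weightF-nonSchröder (t ∷ u ∷ ts) nsch)) (*-zeroʳ (m ^ length ts))

      weightF-nonSchröder : ∀ ts → allSch ts ≡ false → weightF ts ≡ 0
      weightF-nonSchröder [] ()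
      weightF-nonSchröder (t ∷ ts) nsch with isSchröder t in t-sch
      ... | false = cong (_* weightF ts) (weight-nonSchröder t t-sch)
      ... | true = trans (cong (weight t *_) (weightF-nonSchröder ts nsch)) (*-zeroʳ (weight t))

    counted : ℕ → ℕ → Tree → Bool
    counted n k t = isSchröder t ∧ (leaves t ≡ᵇ n) ∧ (internal t ≡ᵇ k)

    ∑<-counted : ∀ n t →
      ∑< n (λ k → (if counted n k t then 1 else 0) * m ^ (n ∸ 1 ∸ k)) ≡ weight t * x^ (2 * leaves t) (2 * n)
    ∑<-counted n t rewrite x^-double (leaves t) n with isSchröder t in t-sch
    ... | false = trans (∑<-zero n (λ _ _ → refl)) (sym (cong (_* _) (weight-nonSchröder t t-sch)))
    ... | true with weight-schröder t t-sch
    ... | r , leaves≡ , weight≡ with leaves t ≡ᵇ n in leaves≡ᵇn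
    ... | false = trans (∑<-zero n (λ _ _ → refl)) (sym (*-zeroʳ (weight t)))
    ... | true = begin
      ∑< n (λ k → (if internal t ≡ᵇ k then 1 else 0) * m ^ (n ∸ 1 ∸ k))  ≡⟨ ∑<-pick n (internal t) _ internal<n ⟩
      m ^ (n ∸ 1 ∸ internal t)  ≡⟨ cong (m ^_) exponent ⟩
      m ^ r                     ≡⟨ sym weight≡ ⟩
      weight t                  ≡⟨ sym (*-identityʳ (weight t)) ⟩
      weight t * 1              ∎
      where
      n≡ : n ≡ r + suc (internal t)
      n≡ = trans (sym (≡ᵇ⇒≡ (leaves t) n (subst T (sym leaves≡ᵇn) _))) leaves≡
      internal<n : internal t < n
      internal<n = subst (internal t <_) (sym n≡) (m≤n+m (suc (internal t)) r)
      exponent : n ∸ 1 ∸ internal t ≡ r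
      exponent = trans (∸-+-assoc n 1 (internal t)) (trans (cong (_∸ suc (internal t)) n≡) (m+n∸n≡m r (suc (internal t))))

    schröderSum≡treeSeries : ∀ n → schröderSum m n ≡ treeSeries (treesBounded n n) (2 * n)
    schröderSum≡treeSeries n = begin
      schröderSum m n
        ≡⟨ ∑<-cong n (λ k _ → trans (cong (_* m ^ (n ∸ 1 ∸ k)) (count k))
             (sym (∑-*ʳ TB _ (λ t → if counted n k t then 1 else 0)))) ⟩
      ∑< n (λ k → ∑ TB (λ t → (if counted n k t then 1 else 0) * m ^ (n ∸ 1 ∸ k)))
        ≡⟨ ∑<-∑ n TB (λ k t → (if counted n k t then 1 else 0) * m ^ (n ∸ 1 ∸ k)) ⟩
      ∑ TB (λ t → ∑< n (λ k → (if counted n k t then 1 else 0) * m ^ (n ∸ 1 ∸ k)))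
        ≡⟨ ∑-cong TB (∑<-counted n) ⟩
      treeSeries TB (2 * n) ∎
      where
      TB = treesBounded n n
      count : ∀ k → s n k ≡ ∑ TB (λ t → if counted n k t then 1 else 0)
      count k = trans (length-∑ (filter (λ t → T? (counted n k t)) TB)) (∑-filter (counted n k) TB (λ _ → 1))

  module Comparison (m : ℕ) where
    open SchröderPaths m
    open WeightedTrees m

    treeSeries-zeroBelow : ∀ xs → ZeroBelow 2 (treeSeries xs)
    treeSeries-zeroBelow xs i i<2 = trans (∑-cong xs term) (∑-zero xs)
      where
      term : ∀ t → weight t * x^ (2 * leaves t) i ≡ 0
      term t = trans (cong (weight t *_) (zeroBelow-≤ (*-monoʳ-≤ 2 (leaves-pos t)) (x^-zeroBelow (2 * leaves t)) i i<2))
                     (*-zeroʳ (weight t))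

    G-zeroBelow : ZeroBelow 2 G
    G-zeroBelow zero _ = refl
    G-zeroBelow (suc zero) _ = refl
    G-zeroBelow (suc (suc i)) (s≤s (s≤s ()))

    Y-zeroBelow : ZeroBelow 1 Y
    Y-zeroBelow zero _ = refl
    Y-zeroBelow (suc i) (s≤s ())

    G^⊛-zeroBelow : ∀ j → ZeroBelow 2 (G ^⊛ suc j)
    G^⊛-zeroBelow j = zeroBelow-≤ (m≤m+n 2 (j * 2)) (^⊛-zeroBelow G-zeroBelow (suc j))

    G^⊛⊛Y : ∀ K L → (G ^⊛ suc K ⊛ Y) L ≡ (G ^⊛ suc (suc K)) L + m * (G ^⊛ suc (suc K) ⊛ Y) L
    G^⊛⊛Y K L = begin
      (P ⊛ Y) L                        ≡⟨ ⊛-cong {P} (λ _ → refl) Y-equation L ⟩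
      (P ⊛ (G ⊕ m · (G ⊛ Y))) L        ≡⟨ ⊛-distribˡ-⊕ P G (m · (G ⊛ Y)) L ⟩
      (P ⊛ G) L + (P ⊛ m · (G ⊛ Y)) L  ≡⟨ cong₂ _+_ (⊛-comm P G L) (⊛-·ʳ m P (G ⊛ Y) L) ⟩
      (G ⊛ P) L + m * (P ⊛ (G ⊛ Y)) L  ≡⟨ cong (λ z → (G ⊛ P) L + m * z) (sym (⊛-assoc P G Y L)) ⟩
      (G ⊛ P) L + m * (P ⊛ G ⊛ Y) L
        ≡⟨ cong (λ z → (G ⊛ P) L + m * z) (⊛-cong {P ⊛ G} {G ⊛ P} {Y} (⊛-comm P G) (λ _ → refl) L) ⟩
      (G ⊛ P) L + m * (G ⊛ P ⊛ Y) L    ∎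
      where
      P = G ^⊛ suc K

    G⊛Y-unroll : ∀ K L →
      (G ⊛ Y) L ≡ ∑< (suc K) (λ j → arityWeight (suc j) * (G ^⊛ suc j) L) + m ^ K * (G ^⊛ suc K ⊛ Y) L
    G⊛Y-unroll zero L = sym (trans (+-identityʳ _) (⊛-cong {G ^⊛ 1} {G} {Y} (⊛-𝟙 G) (λ _ → refl) L))
    G⊛Y-unroll (suc K) L = begin
      (G ⊛ Y) L                                  ≡⟨ G⊛Y-unroll K L ⟩
      ∑< (suc K) φ + m ^ K * (G ^⊛ suc K ⊛ Y) L  ≡⟨ cong (λ z → ∑< (suc K) φ + m ^ K * z) (G^⊛⊛Y K L) ⟩
      ∑< (suc K) φ + m ^ K * (φ′ + m * R)        ≡⟨ rearrange (∑< (suc K) φ) (m ^ K) φ′ m R ⟩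
      (∑< (suc K) φ + m ^ K * φ′) + m * m ^ K * R ≡⟨ cong (_+ m * m ^ K * R) (sym (∑<-last (suc K) φ)) ⟩
      ∑< (suc (suc K)) φ + m ^ suc K * R          ∎
      where
      φ : ℕ → ℕ
      φ j = arityWeight (suc j) * (G ^⊛ suc j) L
      φ′ = (G ^⊛ suc (suc K)) L
      R = (G ^⊛ suc (suc K) ⊛ Y) L
      rearrange : ∀ a b c d e → a + b * (c + d * e) ≡ (a + b * c) + d * b * e
      rearrange = solve-∀

    G⊛Y-expansion : ∀ w L → L ≤ 2 * w → (G ⊛ Y) L ≡ ∑< w (λ j → arityWeight (suc j) * (G ^⊛ suc j) L)
    G⊛Y-expansion zero zero _ = refl
    G⊛Y-expansion (suc K) L L≤2w = begin
      (G ⊛ Y) L  ≡⟨ G⊛Y-unroll K L ⟩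
      ∑< (suc K) φ + m ^ K * (G ^⊛ suc K ⊛ Y) L  ≡⟨ cong (λ z → ∑< (suc K) φ + m ^ K * z) remainder ⟩
      ∑< (suc K) φ + m ^ K * 0                  ≡⟨ trans (cong (∑< (suc K) φ +_) (*-zeroʳ (m ^ K))) (+-identityʳ _) ⟩
      ∑< (suc K) φ ∎
      where
      φ : ℕ → ℕ
      φ j = arityWeight (suc j) * (G ^⊛ suc j) L
      remainder : (G ^⊛ suc K ⊛ Y) L ≡ 0
      remainder = ⊛-zeroBelow (^⊛-zeroBelow G-zeroBelow (suc K)) Y-zeroBelow L
        (≤-trans (s≤s (≤-trans L≤2w (≤-reflexive (*-comm 2 (suc K))))) (≤-reflexive (+-comm 1 _)))

    -- Trees of positive weight missing from treesBounded h w have more than h or more than w leaves.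
    treeSeries≡G : ∀ h w L → L ≤ 2 * h → L ≤ 2 * w → treeSeries (treesBounded h w) L ≡ G L
    treeSeries≡G zero w zero _ _ = refl
    treeSeries≡G (suc h) w L L≤2h L≤2w = begin
      treeSeries (treesBounded (suc h) w) L  ≡⟨ treeSeries-treesBounded h w L ⟩
      x^ 2 L + ∑< w (λ j → arityWeight (suc j) * (Tₕ ^⊛ suc j) L)  ≡⟨ cong (x^ 2 L +_) (∑<-cong w (λ j _ → powers j)) ⟩
      x^ 2 L + ∑< w (λ j → arityWeight (suc j) * (G ^⊛ suc j) L)  ≡⟨ cong (x^ 2 L +_) (sym (G⊛Y-expansion w L L≤2w)) ⟩
      x^ 2 L + (G ⊛ Y) L                                          ≡⟨ sym (G-equation L) ⟩
      G L ∎
      where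
      Tₕ = treeSeries (treesBounded h w)
      lower : ∀ i → 2 + i ≤ L → Tₕ i ≡ G i
      lower i 2+i≤L = treeSeries≡G h w i
        (+-cancelˡ-≤ 2 i (2 * h) (≤-trans 2+i≤L (≤-trans L≤2h (≤-reflexive (*-suc 2 h)))))
        (≤-trans (m≤n+m i 2) (≤-trans 2+i≤L L≤2w))
      powers : ∀ j → arityWeight (suc j) * (Tₕ ^⊛ suc j) L ≡ arityWeight (suc j) * (G ^⊛ suc j) L
      powers zero = refl
      powers (suc j) = cong (m ^ j *_) (⊛-cong-zeroBelow (treeSeries-zeroBelow (treesBounded h w)) (G^⊛-zeroBelow j) lower
        (λ i 2+i≤L → ^⊛-agree (λ k k<1+i → lower k (≤-trans (+-monoʳ-≤ 2 (s≤s⁻¹ k<1+i)) 2+i≤L)) (suc j) i ≤-refl))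

  paths≡schröderSum : ∀ m n → SchröderPaths.paths m 0 (2 * suc n ∸ 2) ≡ schröderSum m (suc n)
  paths≡schröderSum m n = begin
    paths 0 (2 * suc n ∸ 2)  ≡⟨ cong (λ L → paths 0 (L ∸ 2)) (*-suc 2 n) ⟩
    G (2 + 2 * n)             ≡⟨ cong G (sym (*-suc 2 n)) ⟩
    G (2 * suc n)             ≡⟨ sym (treeSeries≡G (suc n) (suc n) (2 * suc n) ≤-refl ≤-refl) ⟩
    treeSeries (treesBounded (suc n) (suc n)) (2 * suc n)  ≡⟨ sym (schröderSum≡treeSeries (suc n)) ⟩
    schröderSum m (suc n)     ∎
    where
    open SchröderPaths m
    open WeightedTrees m
    open SchröderWeights m
    open Comparison m

  weighted-𝒫 : ∀ m n → sum (map (λ P → m ^ flats P) (𝒫 (suc n))) ≡ schröderSum m (suc n)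
  weighted-𝒫 m n = trans (∑-filter isSmallSchröder (words (2 * suc n ∸ 2)) (λ P → m ^ flats P)) (paths≡schröderSum m n)

  weighted-𝒟 : ∀ m n → sum (map (λ P → suc m ^ valleys P) (𝒟 (suc n))) ≡ schröderSum m (suc n)
  weighted-𝒟 m n = begin
    sum (map (λ P → suc m ^ valleys P) (𝒟 (suc n)))  ≡⟨ ∑-filter isDyck (words L) (λ P → suc m ^ valleys P) ⟩
    SchröderPaths.dyckPaths m false 0 L             ≡⟨ proj₁ (SchröderPaths.dyck≡paths m L 0) ⟩
    SchröderPaths.paths m 0 L                       ≡⟨ paths≡schröderSum m n ⟩
    schröderSum m (suc n)                           ∎
    where
    L = 2 * suc n ∸ 2

-- Passing to ℚ

open import Data.Nat using (ℕ; _≤_; _^_; _∸_; NonZero; suc)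
open import Data.List using (map)
open import Data.Nat.ListAction using (sum)
open import Data.Integer using (+_)
open import Data.Rational using (ℚ; _/_; _*_)
open import Data.Product using (_×_)
open import Relation.Binary.PropositionalEquality using (_≡_)

import Data.Nat as ℕ
open import Data.Nat using (zero; s≤s; _<_)
import Data.Integer as ℤ
import Data.Integer.Properties as ℤ
open import Data.Rational using (mkℚ; _+_; 1ℚ)
import Data.Rational.Properties as ℚ
open import Data.Nat.Coprimality using (1-coprimeTo)
import Data.Nat.Coprimality as Coprimality
open import Data.List using (List; []; _∷_; upTo)
open import Data.List.Properties using (map-cong-local)
open import Data.List.Relation.Unary.All.Properties using (applyUpTo⁺₁)
open import Data.Product using (_,_; proj₁)
open import Function using (id; _∘_)
open import Relation.Binary.PropositionalEquality using (refl; sym; trans; cong; cong₂; module ≡-Reasoning)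
open ≡-Reasoning
open Counting using (∑<; ∑; ∑-applyUpTo; schröderSum; weighted-𝒫; weighted-𝒟)

ι : ℕ → ℚ
ι a = (+ a) / 1

ι≡mkℚ : ∀ a → ι a ≡ mkℚ (+ a) 0 (Coprimality.sym (1-coprimeTo a))
ι≡mkℚ a = ℚ.normalize-coprime {a} {0} (Coprimality.sym (1-coprimeTo a))

ι-+ : ∀ a b → ι (a ℕ.+ b) ≡ ι a + ι b
ι-+ a b rewrite ι≡mkℚ a | ι≡mkℚ b =
  cong (_/ 1) (trans (ℤ.pos-+ a b) (sym (cong₂ ℤ._+_ (ℤ.*-identityʳ (+ a)) (ℤ.*-identityʳ (+ b)))))

ι-* : ∀ a b → ι (a ℕ.* b) ≡ ι a * ι b
ι-* a b rewrite ι≡mkℚ a | ι≡mkℚ b = cong (_/ 1) (ℤ.pos-* a b)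

ι-*-inverse : ∀ k → ι (suc k) * ((+ 1) / suc k) ≡ 1ℚ
ι-*-inverse k rewrite ι≡mkℚ (suc k) | ℚ.normalize-coprime {1} {k} (1-coprimeTo (suc k)) =
  ℚ.*-inverseʳ (mkℚ (+ suc k) 0 (Coprimality.sym (1-coprimeTo (suc k))))

ι-^-*-inverse : ∀ k {a} j → j ≤ a → ι (suc k ^ a) * (((+ 1) / suc k) ^ℚ j) ≡ ι (suc k ^ (a ∸ j))
ι-^-*-inverse k zero _ = ℚ.*-identityʳ _
ι-^-*-inverse k {suc a} (suc j) (s≤s j≤a) = begin
  ι (m ^ suc a) * (q * q ^ℚ j)    ≡⟨ sym (ℚ.*-assoc (ι (m ^ suc a)) q _) ⟩
  ι (m ℕ.* m ^ a) * q * q ^ℚ j    ≡⟨ cong (λ z → z * q * q ^ℚ j) (trans (ι-* m (m ^ a)) (ℚ.*-comm (ι m) _)) ⟩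
  ι (m ^ a) * ι m * q * q ^ℚ j    ≡⟨ cong (_* q ^ℚ j) cancel ⟩
  ι (m ^ a) * q ^ℚ j              ≡⟨ ι-^-*-inverse k j j≤a ⟩
  ι (m ^ (a ∸ j))                 ∎
  where
  m = suc k
  q = (+ 1) / m
  cancel : ι (m ^ a) * ι m * q ≡ ι (m ^ a)
  cancel = trans (ℚ.*-assoc (ι (m ^ a)) (ι m) q) (trans (cong (ι (m ^ a) *_) (ι-*-inverse k)) (ℚ.*-identityʳ (ι (m ^ a))))

ι-∑ : {A : Set} (xs : List A) (φ : A → ℕ) → ι (∑ xs φ) ≡ sumℚ (map (ι ∘ φ) xs)
ι-∑ [] φ = refl
ι-∑ (x ∷ xs) φ = trans (ι-+ (φ x) _) (cong (λ z → ι (φ x) + z) (ι-∑ xs φ))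

sumℚ-*ˡ : {A : Set} (xs : List A) (c : ℚ) (g : A → ℚ) → sumℚ (map (λ x → c * g x) xs) ≡ c * sumℚ (map g xs)
sumℚ-*ˡ [] c g = sym (ℚ.*-zeroʳ c)
sumℚ-*ˡ (x ∷ xs) c g = trans (cong (λ z → c * g x + z) (sumℚ-*ˡ xs c g)) (sym (ℚ.*-distribˡ-+ c (g x) _))

ι-schröderSum : ∀ k n → ι (schröderSum (suc k) (suc n)) ≡ ι (suc k ^ n) * s[ (+ 1) / suc k ] (suc n)
ι-schröderSum k n = begin
  ι (∑< (suc n) term)                      ≡⟨ cong ι (sym (∑-applyUpTo id (suc n) term)) ⟩
  ι (∑ (upTo (suc n)) term)                ≡⟨ ι-∑ (upTo (suc n)) term ⟩
  sumℚ (map (ι ∘ term) (upTo (suc n)))     ≡⟨ cong sumℚ (map-cong-local (applyUpTo⁺₁ id (suc n) λ {j} → factor j)) ⟩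
  sumℚ (map (λ j → ι (m ^ n) * coefficient j) (upTo (suc n)))  ≡⟨ sumℚ-*ˡ (upTo (suc n)) (ι (m ^ n)) coefficient ⟩
  ι (m ^ n) * s[ q ] (suc n)               ∎
  where
  m = suc k
  q = (+ 1) / m
  term : ℕ → ℕ
  term j = s (suc n) j ℕ.* m ^ (n ∸ j)
  coefficient : ℕ → ℚ
  coefficient j = ι (s (suc n) j) * q ^ℚ j
  factor : ∀ j → j < suc n → ι (term j) ≡ ι (m ^ n) * coefficient j
  factor j (s≤s j≤n) = begin
    ι (s (suc n) j ℕ.* m ^ (n ∸ j))             ≡⟨ ι-* (s (suc n) j) (m ^ (n ∸ j)) ⟩
    ι (s (suc n) j) * ι (m ^ (n ∸ j))           ≡⟨ cong (ι (s (suc n) j) *_) (sym (ι-^-*-inverse k j j≤n)) ⟩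
    ι (s (suc n) j) * (ι (m ^ n) * q ^ℚ j)      ≡⟨ sym (ℚ.*-assoc (ι (s (suc n) j)) _ _) ⟩
    ι (s (suc n) j) * ι (m ^ n) * q ^ℚ j        ≡⟨ cong (_* q ^ℚ j) (ℚ.*-comm (ι (s (suc n) j)) (ι (m ^ n))) ⟩
    ι (m ^ n) * ι (s (suc n) j) * q ^ℚ j        ≡⟨ ℚ.*-assoc (ι (m ^ n)) _ _ ⟩
    ι (m ^ n) * coefficient j                   ∎

corollary11 : (m n : ℕ) → .{{_ : NonZero m}} → 1 ≤ m → 1 ≤ n →
    ((+ sum (map (λ P → m ^ flats P) (𝒫 n))) / 1 ≡ ((+ (m ^ (n ∸ 1))) / 1) * s[ (+ 1) / m ] n)
    × ((+ sum (map (λ P → suc m ^ valleys P) (𝒟 n))) / 1 ≡ ((+ (m ^ (n ∸ 1))) / 1) * s[ (+ 1) / m ] n)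
corollary11 (suc k) (suc n) _ _ = inℚ (weighted-𝒫 (suc k) n) , inℚ (weighted-𝒟 (suc k) n)
  where
  inℚ : ∀ {a} → a ≡ schröderSum (suc k) (suc n) → ι a ≡ ι (suc k ^ n) * s[ (+ 1) / suc k ] (suc n)
  inℚ a≡ = trans (cong ι a≡) (ι-schröderSum k n)
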